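{- Let $n\ge1$. The binary string $\mathcal{DB}_{max}(n)=\overline{\mathcal{D}}_{d}(n)\cdot\mathcal{D}^r_{d'}(n)$, where $d=\lfloor n/2\rfloor+1$ and $d'=\lceil n/2\rceil$, viewed as a circular string, has discrepancy at least $\binom{n-1}{\lfloor n/2\rfloor}+\lfloor n/2\rfloor$.
   Context: The weight of a binary string is its number of $1$s. A necklace is a binary string that is lexicographically smallest among all its rotations. The periodic reduction $\operatorname{pr}(\alpha)$ of $\alpha$ is the shortest prefix $\beta$ of $\alpha$ with $\alpha=\beta^j$ for some $j\ge1$. For $0\le d\le n$, $\mathcal{D}_d(n)$ is the concatenation of $\operatorname{pr}(\alpha)$ over all necklaces $\alpha$ of length $n$ with weight at least $d$, taken in lexicographic order. $\overline{\mathcal{D}}_d(n)$ is the bitwise complement of $\mathcal{D}_d(n)$. $\mathcal{D}^r_d(n)$ is the string obtained from $\mathcal{D}_d(n)$ by moving its suffix $1^{d-1}$ to the front. For a binary string $w$, $|w|_a$ is the number of occurrences of $a$, $\operatorname{csub}(w)$ is the set of substrings of $w$ viewed circularly, and the discrepancy is $\operatorname{disc}(w)=\max_{u\in\operatorname{csub}(w)}\big|\,|u|_1-|u|_0\,\big|$. -}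

module Defs where

open import Data.Bool using (Bool; true; false; not; _∧_; _∨_; if_then_else_)
open import Data.Nat using (ℕ; zero; suc; _+_; _∸_; _≤ᵇ_; _≡ᵇ_; _⊔_; ∣_-_∣)
open import Data.List using (List; []; _∷_; _++_; map; concat; replicate; take; drop; length; filter; upTo; foldr)
open import Data.Bool.ListAction using (all; any)
open import Data.Bool.Properties using (T?)

-- Binary strings: true = 1, false = 0.
BinStr : Set
BinStr = List Bool

countB : Bool → BinStr → ℕ
countB a []       = 0
countB a (x ∷ xs) = (if eqBit a x then 1 else 0) + countB a xs
  where
  eqBit : Bool → Bool → Bool
  eqBit true  true  = true
  eqBit false false = true
  eqBit _     _     = false

weight : BinStr → ℕ
weight = countB true

eqStr : BinStr → BinStr → Bool
eqStr []          []          = true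
eqStr (true ∷ xs) (true ∷ ys) = eqStr xs ys
eqStr (false ∷ xs) (false ∷ ys) = eqStr xs ys
eqStr _           _           = false

lexLeq : BinStr → BinStr → Bool
lexLeq []           _            = true
lexLeq (_ ∷ _)      []           = false
lexLeq (false ∷ xs) (true ∷ ys)  = true
lexLeq (true ∷ xs)  (false ∷ ys) = false
lexLeq (false ∷ xs) (false ∷ ys) = lexLeq xs ys
lexLeq (true ∷ xs)  (true ∷ ys)  = lexLeq xs ys

-- rotation by k positions (k ≤ length)
rot : ℕ → BinStr → BinStr
rot k w = drop k w ++ take k w

isNecklace : BinStr → Bool
isNecklace w = all (λ k → lexLeq w (rot k w)) (upTo (length w))

allStrings : ℕ → List BinStr
allStrings zero    = [] ∷ []
allStrings (suc n) = map (false ∷_) (allStrings n) ++ map (true ∷_) (allStrings n)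

power : ℕ → BinStr → BinStr
power j β = concat (replicate j β)

isRootOf : BinStr → BinStr → Bool
isRootOf β α = any (λ j → eqStr (power j β) α) (map suc (upTo (length α)))

pr : BinStr → BinStr
pr α = firstOr α (filter (λ β → T? (isRootOf β α)) (map (λ p → take p α) (upTo (suc (length α)))))
  where
  firstOr : BinStr → List BinStr → BinStr
  firstOr d []      = d
  firstOr d (x ∷ _) = x

necklacesAtLeast : ℕ → ℕ → List BinStr
necklacesAtLeast d n =
  filter (λ α → T? (isNecklace α ∧ (d ≤ᵇ weight α))) (allStrings n)

D : ℕ → ℕ → BinStr
D d n = concat (map pr (necklacesAtLeast d n))

complement : BinStr → BinStr
complement = map not

Dbar : ℕ → ℕ → BinStr
Dbar d n = complement (D d n)

-- 𝒟^r_d(n): move the suffix 1^{d-1} of 𝒟_d(n) to the front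
Dr : ℕ → ℕ → BinStr
Dr d n = drop k w ++ take k w
  where
  w = D d n
  k = length w ∸ (d ∸ 1)

-- circular substrings of w: for every start position i < |w| and length
-- ℓ ≤ |w|, the string w_i w_{i+1} ... (indices mod |w|), plus the empty string
csub : BinStr → List BinStr
csub w = [] ∷ concat (map (λ i → map (λ ℓ → take ℓ (drop i (w ++ w)))
                                        (upTo (suc (length w))))
                          (upTo (length w)))

maxList : List ℕ → ℕ
maxList = foldr _⊔_ 0

disc : BinStr → ℕ
disc w = maxList (map (λ u → ∣ countB true u - countB false u ∣) (csub w))

module Submission where

-- Write n = a + b with a = ⌊n/2⌋, b = ⌈n/2⌉, d = a + 1, and let
-- 𝒟 = 𝒟_d(n).  We exhibit one circular substring u of 𝒟̄_d(n)·𝒟^r_b(n) with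
-- |u|₀ ≥ |u|₁ + C(n-1,a) + a; the discrepancy bound follows.
--   1. Weight classes: over all strings w of length n and weight ≥ e + 1,
--      Σ (|w|₁ - |w|₀) = n·C(n-1,e), by recursion on n (Pascal's rule).
--   2. Necklace sums: listing every rotation of every necklace α counted in
--      𝒟_d(n) exactly |pr α| times gives a list whose letter counts are n times
--      those of 𝒟_d(n), and which contains every string of weight ≥ d.  As
--      |w|₁ ≥ |w|₀ for those strings when n ≤ 2d, step 1 yields the surplus
--      C(n-1,d-1) + |𝒟_d(n)|₀ ≤ |𝒟_d(n)|₁.
--   3. First necklace: 𝒟_d(c+d) begins with 0^c 1^d (for c, d ≥ 1), hence
--      𝒟̄_d(n) = 1^(b-1)·r and 𝒟^r_b(n) = q·0^a·z with |q| = b - 1.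
--   4. The factor u = r·q·0^a has |u|₁ ≤ |r|₁ + (b-1) = |𝒟|₀ and
--      |u|₀ ≥ |r|₀ + a = |𝒟|₁ + a, so by step 2 |u|₀ - |u|₁ ≥ C(n-1,a) + a.

open import Defs
open import Data.Bool using (Bool; true; false; not; T; _∧_; if_then_else_)
open import Data.Bool.Properties using (T?)
open import Data.Bool.ListAction using (all; any)
open import Data.Nat
open import Data.Nat.Properties
open import Data.Nat.Combinatorics using (_C_; nCk+nC[k+1]≡[n+1]C[k+1])
open import Data.Nat.Tactic.RingSolver using (solve-∀)
open import Data.List using (List; []; _∷_; _++_; map; concat; replicate; take; drop; length; filter; upTo)
open import Data.List.Properties
  using (length-++; ++-assoc; ++-identityʳ; take-all; drop-all; length-drop; length-replicate;
         map-++; map-id; map-∘; map-replicate; length-upTo; filter-none; filter-accept; filter-++)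
open import Data.List.Membership.Propositional using (_∈_)
open import Data.List.Membership.Propositional.Properties
  using (∈-upTo⁻; ∈-upTo⁺; ∈-map⁺; ∈-map⁻; ∈-filter⁺; ∈-filter⁻; ∈-++⁺ˡ; ∈-++⁺ʳ; ∈-++⁻; ∈-concat⁺′; ∈-concat⁻′)
open import Data.List.Relation.Unary.Any using (here; there)
import Data.List.Relation.Unary.All as All
open import Data.List.Relation.Unary.AllPairs using ([]; _∷_)
open import Data.List.Relation.Unary.Unique.Propositional using (Unique)
import Data.List.Relation.Unary.Unique.Propositional.Properties as Unique
open import Data.Product using (Σ; _,_; _×_; proj₁)
open import Data.Sum using (_⊎_; inj₁; inj₂)
open import Data.Empty using (⊥-elim)
open import Relation.Nullary using (¬_; yes; no)
open import Relation.Binary.PropositionalEquality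
open import Function using (_∘_)

sumBy : {X : Set} → (X → ℕ) → List X → ℕ
sumBy f []       = 0
sumBy f (x ∷ xs) = f x + sumBy f xs

sumBy-++ : {X : Set} (f : X → ℕ) (xs ys : List X) → sumBy f (xs ++ ys) ≡ sumBy f xs + sumBy f ys
sumBy-++ f []       ys = refl
sumBy-++ f (x ∷ xs) ys = trans (cong (f x +_) (sumBy-++ f xs ys)) (sym (+-assoc (f x) _ _))

sumBy-map : {X Y : Set} (f : Y → ℕ) (g : X → Y) (xs : List X) → sumBy f (map g xs) ≡ sumBy (f ∘ g) xs
sumBy-map f g []       = refl
sumBy-map f g (x ∷ xs) = cong (f (g x) +_) (sumBy-map f g xs)

sumBy-concat : {X : Set} (f : X → ℕ) (xss : List (List X)) → sumBy f (concat xss) ≡ sumBy (sumBy f) xss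
sumBy-concat f []         = refl
sumBy-concat f (xs ∷ xss) = trans (sumBy-++ f xs (concat xss)) (cong (sumBy f xs +_) (sumBy-concat f xss))

sumBy-cong : {X : Set} {f g : X → ℕ} (xs : List X) → (∀ x → x ∈ xs → f x ≡ g x) → sumBy f xs ≡ sumBy g xs
sumBy-cong []       e = refl
sumBy-cong (x ∷ xs) e = cong₂ _+_ (e x (here refl)) (sumBy-cong xs (λ y y∈ → e y (there y∈)))

sumBy-+ : {X : Set} (f g : X → ℕ) (xs : List X) → sumBy (λ x → f x + g x) xs ≡ sumBy f xs + sumBy g xs
sumBy-+ f g []       = refl
sumBy-+ f g (x ∷ xs) = trans (cong (f x + g x +_) (sumBy-+ f g xs)) (interchange (f x) (g x) _ _)
  where
  interchange : ∀ p q r s → p + q + (r + s) ≡ p + r + (q + s)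
  interchange = solve-∀

sumBy-const : {X : Set} (c : ℕ) (xs : List X) → sumBy (λ _ → c) xs ≡ length xs * c
sumBy-const c []       = refl
sumBy-const c (x ∷ xs) = cong (c +_) (sumBy-const c xs)

sumBy-*ˡ : {X : Set} (k : ℕ) (f : X → ℕ) (xs : List X) → sumBy (λ x → k * f x) xs ≡ k * sumBy f xs
sumBy-*ˡ k f []       = sym (*-zeroʳ k)
sumBy-*ˡ k f (x ∷ xs) = trans (cong (k * f x +_) (sumBy-*ˡ k f xs)) (sym (*-distribˡ-+ k (f x) (sumBy f xs)))

remove : {X : Set} (h : X → ℕ) {x : X} (M : List X) → x ∈ M →
  Σ (List X) λ M' → (sumBy h M ≡ h x + sumBy h M') × (∀ {y} → y ∈ M → y ≢ x → y ∈ M')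
remove h (x ∷ M) (here refl) = M , refl , λ { (here refl) y≢x → ⊥-elim (y≢x refl) ; (there y∈) _ → y∈ }
remove h {x} (z ∷ M) (there x∈M) with remove h M x∈M
... | M' , split , keeps =
  z ∷ M' , trans (cong (h z +_) split) (swap (h z) (h x) (sumBy h M')) ,
  λ { (here refl) _ → here refl ; (there y∈) y≢x → there (keeps y∈ y≢x) }
  where
  swap : ∀ p q r → p + (q + r) ≡ q + (p + r)
  swap = solve-∀

sumBy-cover : {X : Set} (h : X → ℕ) (L M : List X) → Unique L →
  (∀ x → x ∈ L → h x ≡ 0 ⊎ x ∈ M) → sumBy h L ≤ sumBy h M
sumBy-cover h []      M _              covered = z≤n
sumBy-cover h (x ∷ L) M (x∉L ∷ uniqL) covered with covered x (here refl)
... | inj₁ hx≡0 rewrite hx≡0 = sumBy-cover h L M uniqL (λ y y∈ → covered y (there y∈))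
... | inj₂ x∈M with remove h M x∈M
...   | M' , split , keeps =
  subst (h x + sumBy h L ≤_) (sym split) (+-monoʳ-≤ (h x) (sumBy-cover h L M' uniqL covered'))
  where
  covered' : ∀ y → y ∈ L → h y ≡ 0 ⊎ y ∈ M'
  covered' y y∈ with covered y (there y∈)
  ... | inj₁ hy≡0 = inj₁ hy≡0
  ... | inj₂ y∈M  = inj₂ (keeps y∈M (λ y≡x → All.lookup x∉L y∈ (sym y≡x)))

ones zeros : BinStr → ℕ
ones  = countB true
zeros = countB false

countB-∷ : ∀ a x xs → countB a (x ∷ xs) ≡ countB a (x ∷ []) + countB a xs
countB-∷ true  true  xs = refl
countB-∷ true  false xs = refl
countB-∷ false true  xs = refl
countB-∷ false false xs = refl

countB-++ : ∀ a xs ys → countB a (xs ++ ys) ≡ countB a xs + countB a ys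
countB-++ a []       ys = refl
countB-++ a (x ∷ xs) ys = begin
  countB a (x ∷ xs ++ ys)                         ≡⟨ countB-∷ a x (xs ++ ys) ⟩
  countB a (x ∷ []) + countB a (xs ++ ys)         ≡⟨ cong (countB a (x ∷ []) +_) (countB-++ a xs ys) ⟩
  countB a (x ∷ []) + (countB a xs + countB a ys) ≡⟨ sym (+-assoc (countB a (x ∷ [])) _ _) ⟩
  countB a (x ∷ []) + countB a xs + countB a ys   ≡⟨ cong (_+ countB a ys) (sym (countB-∷ a x xs)) ⟩
  countB a (x ∷ xs) + countB a ys                 ∎
  where open ≡-Reasoning

countB-concat : ∀ a (xss : List BinStr) → countB a (concat xss) ≡ sumBy (countB a) xss
countB-concat a []         = refl
countB-concat a (xs ∷ xss) = trans (countB-++ a xs (concat xss)) (cong (countB a xs +_) (countB-concat a xss))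

ones+zeros≡length : ∀ w → ones w + zeros w ≡ length w
ones+zeros≡length []          = refl
ones+zeros≡length (true ∷ w)  = cong suc (ones+zeros≡length w)
ones+zeros≡length (false ∷ w) = trans (+-suc (ones w) (zeros w)) (cong suc (ones+zeros≡length w))

countB≤length : ∀ a w → countB a w ≤ length w
countB≤length true  w = ≤-trans (m≤m+n (ones w) (zeros w)) (≤-reflexive (ones+zeros≡length w))
countB≤length false w = ≤-trans (m≤n+m (zeros w) (ones w)) (≤-reflexive (ones+zeros≡length w))

countB-replicate-same : ∀ a k → countB a (replicate k a) ≡ k
countB-replicate-same a       zero    = refl
countB-replicate-same true    (suc k) = cong suc (countB-replicate-same true k)
countB-replicate-same false   (suc k) = cong suc (countB-replicate-same false k)

countB-replicate-other : ∀ a k → countB a (replicate k (not a)) ≡ 0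
countB-replicate-other a     zero    = refl
countB-replicate-other true  (suc k) = countB-replicate-other true k
countB-replicate-other false (suc k) = countB-replicate-other false k

countB-complement : ∀ a w → countB a (complement w) ≡ countB (not a) w
countB-complement a     []          = refl
countB-complement true  (true ∷ w)  = countB-complement true w
countB-complement true  (false ∷ w) = cong suc (countB-complement true w)
countB-complement false (true ∷ w)  = cong suc (countB-complement false w)
countB-complement false (false ∷ w) = countB-complement false w

countB-power : ∀ a j β → countB a (power j β) ≡ j * countB a β
countB-power a zero    β = refl
countB-power a (suc j) β = trans (countB-++ a β (power j β)) (cong (countB a β +_) (countB-power a j β))

length-power : ∀ j (β : BinStr) → length (power j β) ≡ j * length β
length-power zero    β = refl
length-power (suc j) β = trans (length-++ β) (cong (length β +_) (length-power j β))

take-length-++ : ∀ (x y : BinStr) → take (length x) (x ++ y) ≡ x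
take-length-++ []      y = refl
take-length-++ (a ∷ x) y = cong (a ∷_) (take-length-++ x y)

drop-length-++ : ∀ (x y : BinStr) → drop (length x) (x ++ y) ≡ y
drop-length-++ []      y = refl
drop-length-++ (a ∷ x) y = drop-length-++ x y

take-++-long : ∀ (x y : BinStr) k → length x ≤ k → take k (x ++ y) ≡ x ++ take (k ∸ length x) y
take-++-long []      y k       _         = refl
take-++-long (a ∷ x) y (suc k) (s≤s le) = cong (a ∷_) (take-++-long x y k le)

-- Rotations.  rot k w (from the definition of necklaces) agrees with k-fold
-- rotation by one letter, which composes additively.

rot1 : BinStr → BinStr
rot1 w = drop 1 w ++ take 1 w

rotN : ℕ → BinStr → BinStr
rotN zero    w = w
rotN (suc i) w = rot1 (rotN i w)

rotN-+ : ∀ i j w → rotN i (rotN j w) ≡ rotN (i + j) w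
rotN-+ zero    j w = refl
rotN-+ (suc i) j w = cong rot1 (rotN-+ i j w)

rotN-length : ∀ i w → length (rotN i w) ≡ length w
rotN-length zero    w = refl
rotN-length (suc i) w = trans (rot1-length (rotN i w)) (rotN-length i w)
  where
  rot1-length : ∀ w → length (rot1 w) ≡ length w
  rot1-length []      = refl
  rot1-length (x ∷ w) = trans (length-++ w) (+-comm (length w) 1)

rotN-countB : ∀ a i w → countB a (rotN i w) ≡ countB a w
rotN-countB a zero    w = refl
rotN-countB a (suc i) w = trans (rot1-countB (rotN i w)) (rotN-countB a i w)
  where
  rot1-countB : ∀ w → countB a (rot1 w) ≡ countB a w
  rot1-countB []      = refl
  rot1-countB (x ∷ w) = trans (countB-++ a w (x ∷ [])) (trans (+-comm (countB a w) _) (sym (countB-∷ a x w)))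

drop-step : ∀ k (w : BinStr) → k < length w → Σ Bool λ y → Σ BinStr λ r →
  (drop k w ≡ y ∷ r) × (drop (suc k) w ≡ r) × (take (suc k) w ≡ take k w ++ (y ∷ []))
drop-step zero    (x ∷ w) _        = x , w , refl , refl , refl
drop-step (suc k) (x ∷ w) (s≤s lt) with drop-step k w lt
... | y , r , dropₖ , dropₖ₊₁ , takeₖ₊₁ = y , r , dropₖ , dropₖ₊₁ , cong (x ∷_) takeₖ₊₁

rot≡rotN : ∀ k w → k ≤ length w → rot k w ≡ rotN k w
rot≡rotN zero    w _  = ++-identityʳ w
rot≡rotN (suc k) w lt with drop-step k w lt
... | y , r , dropₖ , dropₖ₊₁ , takeₖ₊₁ = begin
  drop (suc k) w ++ take (suc k) w   ≡⟨ cong₂ _++_ dropₖ₊₁ takeₖ₊₁ ⟩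
  r ++ (take k w ++ (y ∷ []))        ≡⟨ sym (++-assoc r (take k w) _) ⟩
  rot1 ((y ∷ r) ++ take k w)         ≡⟨ cong (λ t → rot1 (t ++ take k w)) (sym dropₖ) ⟩
  rot1 (rot k w)                     ≡⟨ cong rot1 (rot≡rotN k w (<⇒≤ lt)) ⟩
  rotN (suc k) w                     ∎
  where open ≡-Reasoning

rotN-length-id : ∀ w → rotN (length w) w ≡ w
rotN-length-id w = begin
  rotN (length w) w                          ≡⟨ sym (rot≡rotN (length w) w ≤-refl) ⟩
  drop (length w) w ++ take (length w) w     ≡⟨ cong₂ _++_ (drop-all (length w) w ≤-refl) (take-all (length w) w ≤-refl) ⟩
  w                                          ∎
  where open ≡-Reasoning

rotN-periodic : ∀ q x → 1 ≤ q → rotN q x ≡ x → ∀ i → Σ ℕ λ r → r < q × rotN i x ≡ rotN r x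
rotN-periodic q x q≥1 fixed zero = 0 , q≥1 , refl
rotN-periodic q x q≥1 fixed (suc i) with rotN-periodic q x q≥1 fixed i
... | r , r<q , eq with suc r <? q
...   | yes r+1<q = suc r , r+1<q , cong rot1 eq
...   | no  r+1≮q = 0 , q≥1 , trans (cong rot1 eq)
          (trans (cong (λ t → rotN t x) (≤-antisym r<q (≮⇒≥ r+1≮q))) fixed)

lex-refl : ∀ w → lexLeq w w ≡ true
lex-refl []          = refl
lex-refl (true ∷ w)  = lex-refl w
lex-refl (false ∷ w) = lex-refl w

lex-total : ∀ u v → lexLeq u v ≡ false → lexLeq v u ≡ true
lex-total []          v           ()
lex-total (x ∷ u)     []          _  = refl
lex-total (false ∷ u) (true ∷ v)  ()
lex-total (true ∷ u)  (false ∷ v) _  = refl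
lex-total (false ∷ u) (false ∷ v) e  = lex-total u v e
lex-total (true ∷ u)  (true ∷ v)  e  = lex-total u v e

lex-trans : ∀ u v w → lexLeq u v ≡ true → lexLeq v w ≡ true → lexLeq u w ≡ true
lex-trans []          v           w           _ _ = refl
lex-trans (x ∷ u)     []          w           () _
lex-trans (x ∷ u)     (y ∷ v)     []          _ ()
lex-trans (false ∷ u) (false ∷ v) (false ∷ w) p q = lex-trans u v w p q
lex-trans (false ∷ u) (false ∷ v) (true ∷ w)  _ _ = refl
lex-trans (false ∷ u) (true ∷ v)  (true ∷ w)  _ _ = refl
lex-trans (false ∷ u) (true ∷ v)  (false ∷ w) _ ()
lex-trans (true ∷ u)  (false ∷ v) w           () _
lex-trans (true ∷ u)  (true ∷ v)  (true ∷ w)  p q = lex-trans u v w p q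
lex-trans (true ∷ u)  (true ∷ v)  (false ∷ w) _ ()

least-rotation : ∀ w m → 1 ≤ m →
  Σ ℕ λ k → k < m × (∀ i → i < m → lexLeq (rotN k w) (rotN i w) ≡ true)
least-rotation w (suc zero) _ = 0 , s≤s z≤n , λ { zero _ → lex-refl w ; (suc i) (s≤s ()) }
least-rotation w (suc (suc m)) _ with least-rotation w (suc m) (s≤s z≤n)
... | k , k<m , least with lexLeq (rotN k w) (rotN (suc m) w) in cmp
...   | true  = k , m≤n⇒m≤1+n k<m , extend
  where
  extend : ∀ i → i < suc (suc m) → lexLeq (rotN k w) (rotN i w) ≡ true
  extend i (s≤s i≤m) with i ≟ suc m
  ... | yes refl = cmp
  ... | no  i≢m  = least i (≤∧≢⇒< i≤m i≢m)
...   | false = suc m , ≤-refl , extend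
  where
  extend : ∀ i → i < suc (suc m) → lexLeq (rotN (suc m) w) (rotN i w) ≡ true
  extend i (s≤s i≤m) with i ≟ suc m
  ... | yes refl = lex-refl (rotN (suc m) w)
  ... | no  i≢m  = lex-trans (rotN (suc m) w) (rotN k w) (rotN i w)
                     (lex-total (rotN k w) (rotN (suc m) w) cmp) (least i (≤∧≢⇒< i≤m i≢m))

all-true : ∀ {X : Set} (p : X → Bool) xs → (∀ x → x ∈ xs → p x ≡ true) → all p xs ≡ true
all-true p []       _   = refl
all-true p (x ∷ xs) pxs rewrite pxs x (here refl) = all-true p xs (λ y y∈ → pxs y (there y∈))

necklace-intro : ∀ α → (∀ j → j < length α → lexLeq α (rotN j α) ≡ true) → isNecklace α ≡ true
necklace-intro α below = all-true _ (upTo (length α)) λ j j∈ →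
  let j< = ∈-upTo⁻ j∈ in subst (λ t → lexLeq α t ≡ true) (sym (rot≡rotN j α (<⇒≤ j<))) (below j j<)

necklace-rotation : ∀ w → 1 ≤ length w → Σ ℕ λ k → k < length w × isNecklace (rotN k w) ≡ true
necklace-rotation w nonempty with least-rotation w (length w) nonempty
... | k , k< , least = k , k< , necklace-intro (rotN k w) below
  where
  below : ∀ j → j < length (rotN k w) → lexLeq (rotN k w) (rotN j (rotN k w)) ≡ true
  below j _ with rotN-periodic (length w) w nonempty (rotN-length-id w) (j + k)
  ... | r , r< , eq rewrite rotN-+ j k w | eq = least r r<

eqStr-sound : ∀ u v → eqStr u v ≡ true → u ≡ v
eqStr-sound []          []          _ = refl
eqStr-sound (true ∷ u)  (true ∷ v)  e = cong (true ∷_) (eqStr-sound u v e)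
eqStr-sound (false ∷ u) (false ∷ v) e = cong (false ∷_) (eqStr-sound u v e)
eqStr-sound []          (x ∷ v)     ()
eqStr-sound (true ∷ u)  []          ()
eqStr-sound (false ∷ u) []          ()
eqStr-sound (true ∷ u)  (false ∷ v) ()
eqStr-sound (false ∷ u) (true ∷ v)  ()

any-witness : ∀ {X : Set} (p : X → Bool) xs → any p xs ≡ true → Σ X λ x → x ∈ xs × p x ≡ true
any-witness p []       ()
any-witness p (x ∷ xs) e with p x in px
... | true  = x , here refl , px
... | false with any-witness p xs e
...   | y , y∈ , py = y , there y∈ , py

T⇒≡true : ∀ {b} → T b → b ≡ true
T⇒≡true {true} _ = refl

pr-power : ∀ α → Σ ℕ λ j → power (suc j) (pr α) ≡ α
pr-power α with filter (λ β → T? (isRootOf β α)) (map (λ p → take p α) (upTo (suc (length α)))) in candidates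
... | []    = 0 , ++-identityʳ α
... | β ∷ _ with ∈-filter⁻ (λ β → T? (isRootOf β α)) {xs = map (λ p → take p α) (upTo (suc (length α)))}
                  (subst (β ∈_) (sym candidates) (here refl))
...   | _ , root with any-witness _ (map suc (upTo (length α))) (T⇒≡true root)
...     | j , j∈ , βʲ≡α with ∈-map⁻ suc j∈
...       | j' , _ , refl = j' , eqStr-sound _ _ βʲ≡α

pr-rotation : ∀ α → rotN (length (pr α)) α ≡ α
pr-rotation α with pr-power α
... | j , αᵖ = subst (λ t → rotN (length (pr α)) t ≡ t) αᵖ (begin
  rotN (length β) (β ++ power j β)                         ≡⟨ sym (rot≡rotN (length β) (β ++ power j β) β≤) ⟩
  drop (length β) (β ++ power j β) ++ take (length β) (β ++ power j β)
                                                           ≡⟨ cong₂ _++_ (drop-length-++ β (power j β)) (take-length-++ β (power j β)) ⟩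
  power j β ++ β                                           ≡⟨ power-comm j ⟩
  β ++ power j β                                           ∎)
  where
  open ≡-Reasoning
  β = pr α
  β≤ : length β ≤ length (β ++ power j β)
  β≤ = ≤-trans (m≤m+n (length β) (length (power j β))) (≤-reflexive (sym (length-++ β)))
  power-comm : ∀ i → power i β ++ β ≡ β ++ power i β
  power-comm zero    = sym (++-identityʳ β)
  power-comm (suc i) = trans (++-assoc β (power i β) β) (cong (β ++_) (power-comm i))

pr-nonempty : ∀ α → 1 ≤ length α → 1 ≤ length (pr α)
pr-nonempty α nonempty with pr-power α | length (pr α) in len
... | _ , _  | suc _ = s≤s z≤n
... | j , αᵖ | zero  = ⊥-elim (<⇒≢ nonempty (sym (begin
  length α                          ≡⟨ cong length (sym αᵖ) ⟩
  length (power (suc j) (pr α))     ≡⟨ length-power (suc j) (pr α) ⟩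
  suc j * length (pr α)             ≡⟨ cong (suc j *_) len ⟩
  suc j * 0                         ≡⟨ *-zeroʳ (suc j) ⟩
  0                                 ∎)))
  where open ≡-Reasoning

pr-countB : ∀ a α → length α * countB a (pr α) ≡ length (pr α) * countB a α
pr-countB a α with pr-power α
... | j , αᵖ = begin
  length α * countB a β                       ≡⟨ cong (λ t → length t * countB a β) (sym αᵖ) ⟩
  length (power (suc j) β) * countB a β       ≡⟨ cong (_* countB a β) (length-power (suc j) β) ⟩
  (suc j * length β) * countB a β             ≡⟨ reorder (suc j) (length β) (countB a β) ⟩
  length β * (suc j * countB a β)             ≡⟨ cong (length β *_) (sym (countB-power a (suc j) β)) ⟩
  length β * countB a (power (suc j) β)       ≡⟨ cong (λ t → length β * countB a t) αᵖ ⟩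
  length β * countB a α                       ∎
  where
  open ≡-Reasoning
  β = pr α
  reorder : ∀ x y z → (x * y) * z ≡ y * (x * z)
  reorder = solve-∀

allStrings-unique : ∀ n → Unique (allStrings n)
allStrings-unique zero    = All.[] ∷ []
allStrings-unique (suc n) =
  Unique.++⁺ (Unique.map⁺ ∷-injective (allStrings-unique n)) (Unique.map⁺ ∷-injective (allStrings-unique n)) disjoint
  where
  ∷-injective : ∀ {b} {x y : BinStr} → b ∷ x ≡ b ∷ y → x ≡ y
  ∷-injective refl = refl
  disjoint : ∀ {v} → ¬ (v ∈ map (false ∷_) (allStrings n) × v ∈ map (true ∷_) (allStrings n))
  disjoint (v∈₀ , v∈₁) with ∈-map⁻ _ v∈₀ | ∈-map⁻ _ v∈₁
  ... | _ , _ , refl | _ , _ , ()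

allStrings-length : ∀ n w → w ∈ allStrings n → length w ≡ n
allStrings-length zero    w (here refl) = refl
allStrings-length (suc n) w w∈ with ∈-++⁻ (map (false ∷_) (allStrings n)) w∈
... | inj₁ w∈₀ with ∈-map⁻ _ w∈₀
...   | v , v∈ , refl = cong suc (allStrings-length n v v∈)
allStrings-length (suc n) w w∈ | inj₂ w∈₁ with ∈-map⁻ _ w∈₁
...   | v , v∈ , refl = cong suc (allStrings-length n v v∈)

allStrings-complete : ∀ n w → length w ≡ n → w ∈ allStrings n
allStrings-complete zero    []          _   = here refl
allStrings-complete (suc n) (false ∷ w) len = ∈-++⁺ˡ (∈-map⁺ (false ∷_) (allStrings-complete n w (cong pred len)))
allStrings-complete (suc n) (true ∷ w)  len =
  ∈-++⁺ʳ (map (false ∷_) (allStrings n)) (∈-map⁺ (true ∷_) (allStrings-complete n w (cong pred len)))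

restrict : ℕ → (BinStr → ℕ) → BinStr → ℕ
restrict d f w = if d ≤ᵇ weight w then f w else 0

Σheavy : ℕ → ℕ → (BinStr → ℕ) → ℕ
Σheavy n d f = sumBy (restrict d f) (allStrings n)

Σheavy-+ : ∀ n d f g → Σheavy n d (λ w → f w + g w) ≡ Σheavy n d f + Σheavy n d g
Σheavy-+ n d f g = trans (sumBy-cong (allStrings n) (λ w _ → restrict-+ w)) (sumBy-+ _ _ (allStrings n))
  where
  restrict-+ : ∀ w → restrict d (λ w → f w + g w) w ≡ restrict d f w + restrict d g w
  restrict-+ w with d ≤ᵇ weight w
  ... | true  = refl
  ... | false = refl

Σheavy-suc : ∀ n d f → Σheavy (suc n) d f ≡ Σheavy n d (f ∘ (false ∷_)) + Σheavy n (d ∸ 1) (f ∘ (true ∷_))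
Σheavy-suc n d f = trans (sumBy-++ (restrict d f) (map (false ∷_) (allStrings n)) _)
  (cong₂ _+_ (sumBy-map (restrict d f) _ (allStrings n))
             (trans (sumBy-map (restrict d f) _ (allStrings n)) (sumBy-cong (allStrings n) (λ w _ → leading-one d w))))
  where
  leading-one : ∀ d w → restrict d f (true ∷ w) ≡ restrict (d ∸ 1) (f ∘ (true ∷_)) w
  leading-one zero    w = refl
  leading-one (suc zero)    w = refl
  leading-one (suc (suc e)) w = refl

Count Ones Zeros : ℕ → ℕ → ℕ
Count n d = Σheavy n d (λ _ → 1)
Ones  n d = Σheavy n d ones
Zeros n d = Σheavy n d zeros

Count-suc : ∀ n d → Count (suc n) d ≡ Count n d + Count n (d ∸ 1)
Count-suc n d = Σheavy-suc n d (λ _ → 1)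

Ones-suc : ∀ n d → Ones (suc n) d ≡ Ones n d + (Count n (d ∸ 1) + Ones n (d ∸ 1))
Ones-suc n d = trans (Σheavy-suc n d ones) (cong (Ones n d +_) (Σheavy-+ n (d ∸ 1) (λ _ → 1) ones))

Zeros-suc : ∀ n d → Zeros (suc n) d ≡ (Count n d + Zeros n d) + Zeros n (d ∸ 1)
Zeros-suc n d = trans (Σheavy-suc n d zeros) (cong (_+ Zeros n (d ∸ 1)) (Σheavy-+ n d (λ _ → 1) zeros))

Count-layer : ∀ n d → Count n d ≡ Count n (suc d) + n C d
Count-layer zero    zero    = refl
Count-layer zero    (suc d) = refl
Count-layer (suc n) zero    = begin
  Count (suc n) 0                           ≡⟨ Count-suc n 0 ⟩
  Count n 0 + Count n 0                     ≡⟨ cong (_+ Count n 0) (Count-layer n 0) ⟩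
  (Count n 1 + 1) + Count n 0               ≡⟨ reorder (Count n 1) (Count n 0) ⟩
  (Count n 1 + Count n 0) + 1               ≡⟨ cong (_+ 1) (sym (Count-suc n 1)) ⟩
  Count (suc n) 1 + 1                       ∎
  where
  open ≡-Reasoning
  reorder : ∀ x y → (x + 1) + y ≡ (x + y) + 1
  reorder = solve-∀
Count-layer (suc n) (suc d) = begin
  Count (suc n) (suc d)
    ≡⟨ Count-suc n (suc d) ⟩
  Count n (suc d) + Count n d
    ≡⟨ cong₂ _+_ (Count-layer n (suc d)) (Count-layer n d) ⟩
  (Count n (2 + d) + n C suc d) + (Count n (suc d) + n C d)
    ≡⟨ reorder (Count n (2 + d)) (Count n (suc d)) (n C suc d) (n C d) ⟩
  (Count n (2 + d) + Count n (suc d)) + (n C d + n C suc d)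
    ≡⟨ cong₂ _+_ (sym (Count-suc n (2 + d))) (nCk+nC[k+1]≡[n+1]C[k+1] n d) ⟩
  Count (suc n) (2 + d) + suc n C suc d     ∎
  where
  open ≡-Reasoning
  reorder : ∀ x y p q → (x + p) + (y + q) ≡ (x + y) + (q + p)
  reorder = solve-∀

Ones≡Zeros-all : ∀ n → Ones n 0 ≡ Zeros n 0
Ones≡Zeros-all zero    = refl
Ones≡Zeros-all (suc n) = begin
  Ones (suc n) 0                            ≡⟨ Ones-suc n 0 ⟩
  Ones n 0 + (Count n 0 + Ones n 0)         ≡⟨ cong (λ t → t + (Count n 0 + t)) (Ones≡Zeros-all n) ⟩
  Zeros n 0 + (Count n 0 + Zeros n 0)       ≡⟨ +-comm (Zeros n 0) _ ⟩
  (Count n 0 + Zeros n 0) + Zeros n 0       ≡⟨ sym (Zeros-suc n 0) ⟩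
  Zeros (suc n) 0                           ∎
  where open ≡-Reasoning

-- Pascal's rule scaled by m, in the shape the surplus recursion produces.
scaled-pascal : ∀ m f → m * ((m ∸ 1) C suc f) + m * ((m ∸ 1) C f) ≡ m * (m C suc f)
scaled-pascal zero    f = refl
scaled-pascal (suc m) f = begin
  suc m * (m C suc f) + suc m * (m C f)     ≡⟨ sym (*-distribˡ-+ (suc m) (m C suc f) (m C f)) ⟩
  suc m * (m C suc f + m C f)               ≡⟨ cong (suc m *_) (+-comm (m C suc f) (m C f)) ⟩
  suc m * (m C f + m C suc f)               ≡⟨ cong (suc m *_) (nCk+nC[k+1]≡[n+1]C[k+1] m f) ⟩
  suc m * (suc m C suc f)                   ∎
  where open ≡-Reasoning

Ones-surplus : ∀ n e → Ones n (suc e) ≡ Zeros n (suc e) + n * ((n ∸ 1) C e)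
Ones-surplus zero    e    = refl
Ones-surplus (suc m) zero = begin
  Ones (suc m) 1
    ≡⟨ Ones-suc m 1 ⟩
  Ones m 1 + (Count m 0 + Ones m 0)
    ≡⟨ cong₂ (λ x y → x + (y + Ones m 0)) (Ones-surplus m 0) (Count-layer m 0) ⟩
  (Zeros m 1 + m * 1) + ((Count m 1 + 1) + Ones m 0)
    ≡⟨ cong (λ t → (Zeros m 1 + m * 1) + ((Count m 1 + 1) + t)) (Ones≡Zeros-all m) ⟩
  (Zeros m 1 + m * 1) + ((Count m 1 + 1) + Zeros m 0)
    ≡⟨ reorder (Zeros m 1) m (Count m 1) (Zeros m 0) ⟩
  (Count m 1 + Zeros m 1) + Zeros m 0 + suc m * 1
    ≡⟨ cong (_+ suc m * 1) (sym (Zeros-suc m 1)) ⟩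
  Zeros (suc m) 1 + suc m * 1               ∎
  where
  open ≡-Reasoning
  reorder : ∀ z m c y → (z + m * 1) + ((c + 1) + y) ≡ (c + z) + y + (1 + m) * 1
  reorder = solve-∀
Ones-surplus (suc m) (suc f) = begin
  Ones (suc m) e₂
    ≡⟨ Ones-suc m e₂ ⟩
  Ones m e₂ + (Count m e₁ + Ones m e₁)
    ≡⟨ cong₂ (λ x y → x + y) (Ones-surplus m e₁) (cong₂ _+_ (Count-layer m e₁) (Ones-surplus m f)) ⟩
  (Zeros m e₂ + p) + ((Count m e₂ + c) + (Zeros m e₁ + q))
    ≡⟨ reorder (Zeros m e₂) p (Count m e₂) c (Zeros m e₁) q ⟩
  (Count m e₂ + Zeros m e₂) + Zeros m e₁ + (c + (p + q))
    ≡⟨ cong (λ t → (Count m e₂ + Zeros m e₂) + Zeros m e₁ + (c + t)) (scaled-pascal m f) ⟩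
  (Count m e₂ + Zeros m e₂) + Zeros m e₁ + (c + m * c)
    ≡⟨ cong (_+ (c + m * c)) (sym (Zeros-suc m e₂)) ⟩
  Zeros (suc m) e₂ + suc m * c              ∎
  where
  open ≡-Reasoning
  e₁ = suc f
  e₂ = suc (suc f)
  p = m * ((m ∸ 1) C suc f)
  q = m * ((m ∸ 1) C f)
  c = m C suc f
  reorder : ∀ z p b c y q → (z + p) + ((b + c) + (y + q)) ≡ (b + z) + y + (c + (p + q))
  reorder = solve-∀

-- Rotation classes.  orbit α lists the |pr α| distinct rotations of α, and
-- rotationsAtLeast d n collects the orbits of the necklaces counted in 𝒟_d(n).

orbit : BinStr → List BinStr
orbit α = map (λ i → rotN i α) (upTo (length (pr α)))

rotationsAtLeast : ℕ → ℕ → List BinStr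
rotationsAtLeast d n = concat (map orbit (necklacesAtLeast d n))

T-∧ʳ : ∀ {p q} → T (p ∧ q) → T q
T-∧ʳ {true} t = t

necklacesAtLeast-member : ∀ d n α → α ∈ necklacesAtLeast d n → (length α ≡ n) × (d ≤ weight α)
necklacesAtLeast-member d n α α∈ with ∈-filter⁻ (λ α → T? (isNecklace α ∧ (d ≤ᵇ weight α))) {xs = allStrings n} α∈
... | α∈all , selected = allStrings-length n α α∈all , ≤ᵇ⇒≤ d (weight α) (T-∧ʳ selected)

rotationsAtLeast-member : ∀ d n x → x ∈ rotationsAtLeast d n → (length x ≡ n) × (d ≤ weight x)
rotationsAtLeast-member d n x x∈ with ∈-concat⁻′ (map orbit (necklacesAtLeast d n)) x∈
... | xs , x∈xs , xs∈ with ∈-map⁻ orbit xs∈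
...   | α , α∈ , refl with ∈-map⁻ (λ i → rotN i α) x∈xs
...     | i , _ , refl with necklacesAtLeast-member d n α α∈
...       | len , heavy = trans (rotN-length i α) len , subst (d ≤_) (sym (rotN-countB true i α)) heavy

heavy-∈-rotationsAtLeast : ∀ d n w → 1 ≤ n → w ∈ allStrings n → d ≤ weight w → w ∈ rotationsAtLeast d n
heavy-∈-rotationsAtLeast d n w n≥1 w∈ heavy with allStrings-length n w w∈
... | refl with necklace-rotation w n≥1
...   | k , k< , necklace = ∈-concat⁺′ w∈orbit (∈-map⁺ orbit α∈)
  where
  α = rotN k w
  α∈ : α ∈ necklacesAtLeast d (length w)
  α∈ = ∈-filter⁺ (λ α → T? (isNecklace α ∧ (d ≤ᵇ weight α))) (allStrings-complete (length w) α (rotN-length k w))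
         (subst (λ b → T (b ∧ (d ≤ᵇ weight α))) (sym necklace) (≤⇒≤ᵇ (subst (d ≤_) (sym (rotN-countB true k w)) heavy)))
  back : rotN (length w ∸ k) α ≡ w
  back = trans (rotN-+ (length w ∸ k) k w) (trans (cong (λ t → rotN t w) (m∸n+n≡m (<⇒≤ k<))) (rotN-length-id w))
  w∈orbit : w ∈ orbit α
  w∈orbit with rotN-periodic (length (pr α)) α (pr-nonempty α (subst (1 ≤_) (sym (rotN-length k w)) n≥1))
                 (pr-rotation α) (length w ∸ k)
  ... | r , r< , eq = subst (_∈ orbit α) (trans (sym eq) back) (∈-map⁺ (λ i → rotN i α) (∈-upTo⁺ r<))

-- Letter counts over all rotations are n times those of 𝒟_d(n): each necklace α
-- contributes |pr α|·|α|_a = n·|pr α|_a.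
sumBy-rotationsAtLeast : ∀ a d n → sumBy (countB a) (rotationsAtLeast d n) ≡ n * countB a (D d n)
sumBy-rotationsAtLeast a d n = begin
  sumBy (countB a) (concat (map orbit N))              ≡⟨ sumBy-concat (countB a) (map orbit N) ⟩
  sumBy (sumBy (countB a)) (map orbit N)               ≡⟨ sumBy-map (sumBy (countB a)) orbit N ⟩
  sumBy (λ α → sumBy (countB a) (orbit α)) N           ≡⟨ sumBy-cong N (λ α _ → orbit-sum α) ⟩
  sumBy (λ α → length (pr α) * countB a α) N           ≡⟨ sumBy-cong N (λ α α∈ → per-necklace α α∈) ⟩
  sumBy (λ α → n * countB a (pr α)) N                  ≡⟨ sumBy-*ˡ n (countB a ∘ pr) N ⟩
  n * sumBy (countB a ∘ pr) N                          ≡⟨ cong (n *_) (sym (sumBy-map (countB a) pr N)) ⟩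
  n * sumBy (countB a) (map pr N)                      ≡⟨ cong (n *_) (sym (countB-concat a (map pr N))) ⟩
  n * countB a (D d n)                                 ∎
  where
  open ≡-Reasoning
  N = necklacesAtLeast d n
  orbit-sum : ∀ α → sumBy (countB a) (orbit α) ≡ length (pr α) * countB a α
  orbit-sum α = begin
    sumBy (countB a) (orbit α)                             ≡⟨ sumBy-map (countB a) (λ i → rotN i α) (upTo (length (pr α))) ⟩
    sumBy (λ i → countB a (rotN i α)) (upTo (length (pr α))) ≡⟨ sumBy-cong (upTo (length (pr α))) (λ i _ → rotN-countB a i α) ⟩
    sumBy (λ _ → countB a α) (upTo (length (pr α)))        ≡⟨ sumBy-const (countB a α) (upTo (length (pr α))) ⟩
    length (upTo (length (pr α))) * countB a α             ≡⟨ cong (_* countB a α) (length-upTo (length (pr α))) ⟩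
    length (pr α) * countB a α                             ∎
  per-necklace : ∀ α → α ∈ N → length (pr α) * countB a α ≡ n * countB a (pr α)
  per-necklace α α∈ = trans (sym (pr-countB a α)) (cong (_* countB a (pr α)) (proj₁ (necklacesAtLeast-member d n α α∈)))

heavy-balanced : ∀ d n w → length w ≡ n → n ≤ d + d → d ≤ ones w → zeros w ≤ ones w
heavy-balanced d n w len n≤2d heavy = +-cancelˡ-≤ (ones w) (zeros w) (ones w)
  (≤-trans (≤-reflexive (trans (ones+zeros≡length w) len)) (≤-trans n≤2d (+-mono-≤ heavy heavy)))

-- With h w = |w|₁ - |w|₀ on heavy strings, n·(C(n-1,e) + |𝒟|₀) equals
-- Σ_{heavy} h + Σ_{rotations} |·|₀ ≤ Σ_{rotations} (h + |·|₀) = n·|𝒟|₁.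
D-surplus : ∀ n e → 1 ≤ n → n ≤ suc e + suc e →
  (n ∸ 1) C e + zeros (D (suc e) n) ≤ ones (D (suc e) n)
D-surplus n e n≥1 n≤2d = *-cancelˡ-≤ n {{>-nonZero n≥1}} (begin
  n * ((n ∸ 1) C e + zeros (D d n))                   ≡⟨ *-distribˡ-+ n _ _ ⟩
  n * ((n ∸ 1) C e) + n * zeros (D d n)               ≡⟨ cong₂ _+_ (sym heavy-sum) (sym (sumBy-rotationsAtLeast false d n)) ⟩
  sumBy h (allStrings n) + sumBy zeros R              ≤⟨ +-monoˡ-≤ (sumBy zeros R) (sumBy-cover h (allStrings n) R (allStrings-unique n) covered) ⟩
  sumBy h R + sumBy zeros R                           ≡⟨ sym (sumBy-+ h zeros R) ⟩
  sumBy (λ w → h w + zeros w) R                       ≡⟨ sumBy-cong R (λ w w∈ → h+zeros w (rotationsAtLeast-member d n w w∈)) ⟩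
  sumBy ones R                                        ≡⟨ sumBy-rotationsAtLeast true d n ⟩
  n * ones (D d n)                                    ∎)
  where
  open ≤-Reasoning
  d = suc e
  R = rotationsAtLeast d n
  h : BinStr → ℕ
  h = restrict d (λ w → ones w ∸ zeros w)
  h+zeros : ∀ w → (length w ≡ n) × (d ≤ weight w) → h w + zeros w ≡ ones w
  h+zeros w (len , heavy) with d ≤ᵇ weight w in sel
  ... | true  = m∸n+n≡m (heavy-balanced d n w len n≤2d heavy)
  ... | false = ⊥-elim (subst T sel (≤⇒≤ᵇ heavy))
  heavy-sum : sumBy h (allStrings n) ≡ n * ((n ∸ 1) C e)
  heavy-sum = +-cancelʳ-≡ (Zeros n d) _ _ (begin-equality
    Σheavy n d (λ w → ones w ∸ zeros w) + Zeros n d    ≡⟨ sym (Σheavy-+ n d _ zeros) ⟩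
    Σheavy n d (λ w → ones w ∸ zeros w + zeros w)      ≡⟨ sumBy-cong (allStrings n) (λ w w∈ → restrict-balanced w (allStrings-length n w w∈)) ⟩
    Ones n d                                           ≡⟨ Ones-surplus n e ⟩
    Zeros n d + n * ((n ∸ 1) C e)                      ≡⟨ +-comm (Zeros n d) _ ⟩
    n * ((n ∸ 1) C e) + Zeros n d                      ∎)
    where
    restrict-balanced : ∀ w → length w ≡ n → restrict d (λ w → ones w ∸ zeros w + zeros w) w ≡ restrict d ones w
    restrict-balanced w len with d ≤ᵇ weight w in sel
    ... | true  = m∸n+n≡m (heavy-balanced d n w len n≤2d (≤ᵇ⇒≤ d (weight w) (subst T (sym sel) _)))
    ... | false = refl
  covered : ∀ w → w ∈ allStrings n → h w ≡ 0 ⊎ w ∈ R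
  covered w w∈ with d ≤ᵇ weight w in sel
  ... | false = inj₁ refl
  ... | true  = inj₂ (heavy-∈-rotationsAtLeast d n w n≥1 w∈ (≤ᵇ⇒≤ d (weight w) (subst T (sym sel) _)))

-- The first necklace: for c, d ≥ 1 the lexicographically least string of length
-- c + d and weight d is the aperiodic necklace 0^c 1^d, so 𝒟_d(c+d) starts with it.

zeroBlock oneBlock : ℕ → BinStr
zeroBlock c = replicate c false
oneBlock  d = replicate d true

firstNecklace : ℕ → ℕ → BinStr
firstNecklace c d = zeroBlock c ++ oneBlock d

firstNecklace-length : ∀ c d → length (firstNecklace c d) ≡ c + d
firstNecklace-length c d = trans (length-++ (zeroBlock c)) (cong₂ _+_ (length-replicate c) (length-replicate d))

firstNecklace-weight : ∀ c d → weight (firstNecklace c d) ≡ d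
firstNecklace-weight c d =
  trans (countB-++ true (zeroBlock c) (oneBlock d)) (cong₂ _+_ (countB-replicate-other true c) (countB-replicate-same true d))

firstNecklace-zeros : ∀ c d → zeros (firstNecklace c d) ≡ c
firstNecklace-zeros c d = trans (countB-++ false (zeroBlock c) (oneBlock d))
  (trans (cong₂ _+_ (countB-replicate-same false c) (countB-replicate-other false d)) (+-identityʳ c))

firstNecklace-least : ∀ c d w → length w ≡ c + d → weight w ≡ d → lexLeq (firstNecklace c d) w ≡ true
firstNecklace-least zero    d       w           len wt = all-ones d w len wt
  where
  all-ones : ∀ d w → length w ≡ d → weight w ≡ d → lexLeq (oneBlock d) w ≡ true
  all-ones zero    w           _   _  = refl
  all-ones (suc d) (true ∷ w)  len wt = all-ones d w (cong pred len) (cong pred wt)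
  all-ones (suc d) (false ∷ w) len wt =
    ⊥-elim (<-irrefl refl (≤-trans (≤-reflexive (sym wt)) (≤-trans (countB≤length true w) (≤-reflexive (cong pred len)))))
firstNecklace-least (suc c) d (false ∷ w) len wt = firstNecklace-least c d w (cong pred len) wt
firstNecklace-least (suc c) d (true ∷ w)  _   _  = refl

firstNecklace-necklace : ∀ c d → isNecklace (firstNecklace c d) ≡ true
firstNecklace-necklace c d = necklace-intro α λ j _ →
  firstNecklace-least c d (rotN j α) (trans (rotN-length j α) (firstNecklace-length c d))
                                     (trans (rotN-countB true j α) (firstNecklace-weight c d))
  where α = firstNecklace c d

prefix-zeros : ∀ c d β γ → β ++ γ ≡ firstNecklace c d → 1 ≤ ones β → zeros β ≡ c
prefix-zeros zero d β γ eq _ = n≤0⇒n≡0 (≤-trans (m≤m+n (zeros β) (zeros γ))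
  (≤-reflexive (trans (sym (countB-++ false β γ)) (trans (cong zeros eq) (countB-replicate-other false d)))))
prefix-zeros (suc c) d []          γ eq ()
prefix-zeros (suc c) d (true ∷ β)  γ () _
prefix-zeros (suc c) d (false ∷ β) γ eq β₁ = cong suc (prefix-zeros c d β γ (cong (drop 1) eq) β₁)

-- 0^c 1^d is aperiodic: a proper root would have both c zeros and fewer than c.
firstNecklace-aperiodic : ∀ c d → 1 ≤ c → 1 ≤ d → pr (firstNecklace c d) ≡ firstNecklace c d
firstNecklace-aperiodic c d c≥1 d≥1 with pr-power (firstNecklace c d)
... | zero  , αᵖ = trans (sym (++-identityʳ (pr (firstNecklace c d)))) αᵖ
... | suc j , αᵖ = ⊥-elim (<-irrefl refl (≤-trans c<kc (≤-reflexive kc≡c)))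
  where
  β = pr (firstNecklace c d)
  k = suc (suc j)
  β-has-one : 1 ≤ ones β
  β-has-one with ones β in onesβ
  ... | suc _ = s≤s z≤n
  ... | zero  = ⊥-elim (<-irrefl refl (≤-trans d≥1 (≤-reflexive (begin
    d                         ≡⟨ sym (firstNecklace-weight c d) ⟩
    ones (firstNecklace c d)  ≡⟨ cong ones (sym αᵖ) ⟩
    ones (power k β)          ≡⟨ countB-power true k β ⟩
    k * ones β                ≡⟨ cong (k *_) onesβ ⟩
    k * 0                     ≡⟨ *-zeroʳ k ⟩
    0                         ∎))))
    where open ≡-Reasoning
  kc≡c : k * c ≡ c
  kc≡c = begin
    k * c                     ≡⟨ cong (k *_) (sym (prefix-zeros c d β (power (suc j) β) αᵖ β-has-one)) ⟩
    k * zeros β               ≡⟨ sym (countB-power false k β) ⟩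
    zeros (power k β)         ≡⟨ cong zeros αᵖ ⟩
    zeros (firstNecklace c d) ≡⟨ firstNecklace-zeros c d ⟩
    c                         ∎
    where open ≡-Reasoning
  c<kc : c < k * c
  c<kc = ≤-trans (subst (_≤ c + c) (+-comm c 1) (+-monoʳ-≤ c c≥1)) (+-monoʳ-≤ c (m≤m+n c (j * c)))

allStrings-zero-prefix : ∀ c d → Σ (List BinStr) λ R → allStrings (c + d) ≡ map (zeroBlock c ++_) (allStrings d) ++ R
allStrings-zero-prefix zero    d = [] , sym (trans (++-identityʳ _) (map-id (allStrings d)))
allStrings-zero-prefix (suc c) d with allStrings-zero-prefix c d
... | R , eq = map (false ∷_) R ++ tail , (begin
  map (false ∷_) (allStrings (c + d)) ++ tail
    ≡⟨ cong (λ t → map (false ∷_) t ++ tail) eq ⟩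
  map (false ∷_) (map (zeroBlock c ++_) (allStrings d) ++ R) ++ tail
    ≡⟨ cong (_++ tail) (map-++ (false ∷_) (map (zeroBlock c ++_) (allStrings d)) R) ⟩
  (map (false ∷_) (map (zeroBlock c ++_) (allStrings d)) ++ map (false ∷_) R) ++ tail
    ≡⟨ ++-assoc (map (false ∷_) (map (zeroBlock c ++_) (allStrings d))) _ tail ⟩
  map (false ∷_) (map (zeroBlock c ++_) (allStrings d)) ++ (map (false ∷_) R ++ tail)
    ≡⟨ cong (_++ (map (false ∷_) R ++ tail)) (sym (map-∘ (allStrings d))) ⟩
  map (zeroBlock (suc c) ++_) (allStrings d) ++ (map (false ∷_) R ++ tail) ∎)
  where
  open ≡-Reasoning
  tail = map (true ∷_) (allStrings (c + d))

allStrings-last : ∀ d → Σ (List BinStr) λ L → (allStrings d ≡ L ++ (oneBlock d ∷ [])) × (∀ v → v ∈ L → weight v < d)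
allStrings-last zero    = [] , refl , λ v ()
allStrings-last (suc d) with allStrings-last d
... | L , eq , light = map (false ∷_) (allStrings d) ++ map (true ∷_) L , eq′ , light′
  where
  eq′ : allStrings (suc d) ≡ (map (false ∷_) (allStrings d) ++ map (true ∷_) L) ++ (oneBlock (suc d) ∷ [])
  eq′ = trans (cong (λ t → map (false ∷_) (allStrings d) ++ map (true ∷_) t) eq)
          (trans (cong (map (false ∷_) (allStrings d) ++_) (map-++ (true ∷_) L _))
                 (sym (++-assoc (map (false ∷_) (allStrings d)) _ _)))
  light′ : ∀ v → v ∈ map (false ∷_) (allStrings d) ++ map (true ∷_) L → weight v < suc d
  light′ v v∈ with ∈-++⁻ (map (false ∷_) (allStrings d)) v∈
  ... | inj₁ v∈₀ with ∈-map⁻ _ v∈₀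
  ...   | u , u∈ , refl = s≤s (≤-trans (countB≤length true u) (≤-reflexive (allStrings-length d u u∈)))
  light′ v v∈ | inj₂ v∈₁ with ∈-map⁻ _ v∈₁
  ...   | u , u∈ , refl = s≤s (light u u∈)

D-starts-with-firstNecklace : ∀ c d n → c + d ≡ n → 1 ≤ c → 1 ≤ d → Σ BinStr λ r → D d n ≡ firstNecklace c d ++ r
D-starts-with-firstNecklace c d _ refl c≥1 d≥1 with allStrings-zero-prefix c d | allStrings-last d
... | R , eq₁ | L , eq₂ , light = concat (map pr (filter P? R)) , (begin
  concat (map pr (filter P? (allStrings (c + d))))
    ≡⟨ cong (λ t → concat (map pr (filter P? t))) eq₁ ⟩
  concat (map pr (filter P? (map f (allStrings d) ++ R)))
    ≡⟨ cong (λ t → concat (map pr (filter P? (map f t ++ R)))) eq₂ ⟩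
  concat (map pr (filter P? (map f (L ++ (oneBlock d ∷ [])) ++ R)))
    ≡⟨ cong (λ t → concat (map pr (filter P? (t ++ R)))) (map-++ f L _) ⟩
  concat (map pr (filter P? ((map f L ++ (firstNecklace c d ∷ [])) ++ R)))
    ≡⟨ cong (λ t → concat (map pr (filter P? t))) (++-assoc (map f L) _ R) ⟩
  concat (map pr (filter P? (map f L ++ (firstNecklace c d ∷ R))))
    ≡⟨ cong (λ t → concat (map pr t)) (filter-++ P? (map f L) (firstNecklace c d ∷ R)) ⟩
  concat (map pr (filter P? (map f L) ++ filter P? (firstNecklace c d ∷ R)))
    ≡⟨ cong (λ t → concat (map pr (t ++ filter P? (firstNecklace c d ∷ R)))) lighter-rejected ⟩
  concat (map pr (filter P? (firstNecklace c d ∷ R)))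
    ≡⟨ cong (λ t → concat (map pr t)) (filter-accept P? {firstNecklace c d} {R} accepted) ⟩
  pr (firstNecklace c d) ++ concat (map pr (filter P? R))
    ≡⟨ cong (_++ concat (map pr (filter P? R))) (firstNecklace-aperiodic c d c≥1 d≥1) ⟩
  firstNecklace c d ++ concat (map pr (filter P? R)) ∎)
  where
  open ≡-Reasoning
  P? = λ α → T? (isNecklace α ∧ (d ≤ᵇ weight α))
  f = zeroBlock c ++_
  accepted : T (isNecklace (firstNecklace c d) ∧ (d ≤ᵇ weight (firstNecklace c d)))
  accepted rewrite firstNecklace-necklace c d | firstNecklace-weight c d = ≤⇒≤ᵇ (≤-refl {d})
  lighter-rejected : filter P? (map f L) ≡ []
  lighter-rejected = filter-none P? (All.tabulate λ {x} x∈ → rejected x x∈)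
    where
    rejected : ∀ x → x ∈ map f L → ¬ T (isNecklace x ∧ (d ≤ᵇ weight x))
    rejected x x∈ selected with ∈-map⁻ f x∈
    ... | v , v∈ , refl = <⇒≱ (subst (_< d) (sym (trans (countB-++ true (zeroBlock c) v) (cong (_+ weight v) (countB-replicate-other true c)))) (light v v∈))
          (≤ᵇ⇒≤ d (weight (zeroBlock c ++ v)) (T-∧ʳ selected))

factor-∈-csub : ∀ p u v → u ∈ csub (p ++ u ++ v)
factor-∈-csub p []      v = here refl
factor-∈-csub p (x ∷ u) v =
  there (∈-concat⁺′ (subst (_∈ readsFrom (length p)) reads-u (∈-map⁺ (λ ℓ → take ℓ (drop (length p) (s ++ s))) (∈-upTo⁺ ℓ<)))
                    (∈-map⁺ readsFrom (∈-upTo⁺ p<)))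
  where
  s = p ++ (x ∷ u) ++ v
  readsFrom : ℕ → List BinStr
  readsFrom i = map (λ ℓ → take ℓ (drop i (s ++ s))) (upTo (suc (length s)))
  ℓ = length (x ∷ u)
  length-s : length s ≡ length p + (ℓ + length v)
  length-s = trans (length-++ p) (cong (length p +_) (length-++ (x ∷ u)))
  p< : length p < length s
  p< = subst (length p <_) (sym length-s) (m<m+n (length p) (s≤s z≤n))
  ℓ< : ℓ < suc (length s)
  ℓ< = s≤s (subst (ℓ ≤_) (sym length-s) (≤-trans (m≤m+n ℓ (length v)) (m≤n+m _ (length p))))
  reads-u : take ℓ (drop (length p) (s ++ s)) ≡ x ∷ u
  reads-u = begin
    take ℓ (drop (length p) ((p ++ (x ∷ u) ++ v) ++ s))  ≡⟨ cong (λ t → take ℓ (drop (length p) t)) (++-assoc p _ s) ⟩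
    take ℓ (drop (length p) (p ++ ((x ∷ u) ++ v) ++ s))  ≡⟨ cong (take ℓ) (drop-length-++ p _) ⟩
    take ℓ (((x ∷ u) ++ v) ++ s)                         ≡⟨ cong (take ℓ) (++-assoc (x ∷ u) v s) ⟩
    take ℓ ((x ∷ u) ++ v ++ s)                           ≡⟨ take-length-++ (x ∷ u) (v ++ s) ⟩
    x ∷ u                                                ∎
    where open ≡-Reasoning

disc-≥ : ∀ s u → u ∈ csub s → ∣ ones u - zeros u ∣ ≤ disc s
disc-≥ s u u∈ = maxList-≥ (∈-map⁺ (λ u → ∣ countB true u - countB false u ∣) u∈)
  where
  maxList-≥ : ∀ {x xs} → x ∈ xs → x ≤ maxList xs
  maxList-≥ {xs = y ∷ xs} (here refl) = m≤m⊔n y (maxList xs)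
  maxList-≥ {xs = y ∷ xs} (there x∈)  = ≤-trans (maxList-≥ x∈) (m≤n⊔m y (maxList xs))

surplus≤∣-∣ : ∀ x y k → x + k ≤ y → k ≤ ∣ x - y ∣
surplus≤∣-∣ x y k x+k≤y = subst (k ≤_) (sym (m≤n⇒∣m-n∣≡n∸m (≤-trans (m≤m+n x k) x+k≤y)))
  (subst (_≤ y ∸ x) (m+n∸m≡n x k) (∸-monoˡ-≤ x x+k≤y))

-- 𝒟̄_d(c+d) begins with 1^c, the complement of the first necklace's zeros.
Dbar-prefix : ∀ c d n → c + d ≡ n → 1 ≤ d → Σ BinStr λ r → Dbar d n ≡ oneBlock c ++ r
Dbar-prefix zero    d n _  _   = Dbar d n , refl
Dbar-prefix (suc c) d n eq d≥1 with D-starts-with-firstNecklace (suc c) d n eq (s≤s z≤n) d≥1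
... | r₀ , D≡ = complement (oneBlock d ++ r₀) , (begin
  complement (D d n)                                           ≡⟨ cong complement D≡ ⟩
  complement (firstNecklace (suc c) d ++ r₀)                   ≡⟨ cong complement (++-assoc (zeroBlock (suc c)) (oneBlock d) r₀) ⟩
  complement (zeroBlock (suc c) ++ oneBlock d ++ r₀)           ≡⟨ map-++ not (zeroBlock (suc c)) _ ⟩
  map not (zeroBlock (suc c)) ++ complement (oneBlock d ++ r₀) ≡⟨ cong (_++ complement (oneBlock d ++ r₀)) (map-replicate not (suc c) false) ⟩
  oneBlock (suc c) ++ complement (oneBlock d ++ r₀)            ∎)
  where open ≡-Reasoning

suffix-to-front : ∀ m w x y → w ≡ x ++ y → m + length x ≤ length w →
  Σ BinStr λ q → Σ BinStr λ z →
    (drop (length w ∸ m) w ++ take (length w ∸ m) w ≡ q ++ x ++ z) × (length q ≡ m)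
suffix-to-front m w x y refl fits =
  drop k w , take (k ∸ length x) y , cong (drop k w ++_) (take-++-long x y k x≤k) , length-q
  where
  k = length w ∸ m
  x≤k : length x ≤ k
  x≤k = subst (_≤ k) (m+n∸m≡n m (length x)) (∸-monoˡ-≤ m fits)
  length-q : length (drop k w) ≡ m
  length-q = trans (length-drop k w) (m∸[m∸n]≡n (≤-trans (m≤m+n m (length x)) fits))

witness-surplus : ∀ (𝒟 r q : BinStr) c a g → complement 𝒟 ≡ oneBlock c ++ r → length q ≡ c →
  g + zeros 𝒟 ≤ ones 𝒟 → ones (r ++ q ++ zeroBlock a) + (g + a) ≤ zeros (r ++ q ++ zeroBlock a)
witness-surplus 𝒟 r q c a g 𝒟̄≡ |q|≡c surplus = begin
  ones (r ++ q ++ zeroBlock a) + (g + a)   ≡⟨ cong (_+ (g + a)) ones-u ⟩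
  ones r + ones q + (g + a)                ≤⟨ +-monoˡ-≤ (g + a) (+-monoʳ-≤ (ones r) (subst (ones q ≤_) |q|≡c (countB≤length true q))) ⟩
  ones r + c + (g + a)                     ≡⟨ cong (_+ (g + a)) (trans (+-comm (ones r) c) ones-𝒟̄) ⟩
  zeros 𝒟 + (g + a)                        ≡⟨ reorder (zeros 𝒟) g a ⟩
  g + zeros 𝒟 + a                          ≤⟨ +-monoˡ-≤ a surplus ⟩
  ones 𝒟 + a                               ≡⟨ cong (_+ a) zeros-𝒟̄ ⟩
  zeros r + a                              ≤⟨ +-monoʳ-≤ (zeros r) (m≤n+m a (zeros q)) ⟩
  zeros r + (zeros q + a)                  ≡⟨ sym zeros-u ⟩
  zeros (r ++ q ++ zeroBlock a)            ∎
  where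
  open ≤-Reasoning
  reorder : ∀ z g a → z + (g + a) ≡ g + z + a
  reorder = solve-∀
  ones-u : ones (r ++ q ++ zeroBlock a) ≡ ones r + ones q
  ones-u = trans (countB-++ true r _) (cong (ones r +_) (trans (countB-++ true q _)
             (trans (cong (ones q +_) (countB-replicate-other true a)) (+-identityʳ (ones q)))))
  zeros-u : zeros (r ++ q ++ zeroBlock a) ≡ zeros r + (zeros q + a)
  zeros-u = trans (countB-++ false r _) (cong (zeros r +_) (trans (countB-++ false q _)
              (cong (zeros q +_) (countB-replicate-same false a))))
  ones-𝒟̄ : c + ones r ≡ zeros 𝒟
  ones-𝒟̄ = begin-equality
    c + ones r                      ≡⟨ cong (_+ ones r) (sym (countB-replicate-same true c)) ⟩
    ones (oneBlock c) + ones r      ≡⟨ sym (countB-++ true (oneBlock c) r) ⟩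
    ones (oneBlock c ++ r)          ≡⟨ cong ones (sym 𝒟̄≡) ⟩
    ones (complement 𝒟)             ≡⟨ countB-complement true 𝒟 ⟩
    zeros 𝒟                         ∎
  zeros-𝒟̄ : ones 𝒟 ≡ zeros r
  zeros-𝒟̄ = begin-equality
    ones 𝒟                          ≡⟨ sym (countB-complement false 𝒟) ⟩
    zeros (complement 𝒟)            ≡⟨ cong zeros 𝒟̄≡ ⟩
    zeros (oneBlock c ++ r)         ≡⟨ countB-++ false (oneBlock c) r ⟩
    zeros (oneBlock c) + zeros r    ≡⟨ cong (_+ zeros r) (countB-replicate-other false c) ⟩
    zeros r                         ∎

discrepancy-from-shapes : ∀ (𝒟 E r q z : BinStr) c a g →
  complement 𝒟 ≡ oneBlock c ++ r → E ≡ q ++ zeroBlock a ++ z → length q ≡ c →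
  g + zeros 𝒟 ≤ ones 𝒟 → g + a ≤ disc (complement 𝒟 ++ E)
discrepancy-from-shapes 𝒟 E r q z c a g 𝒟̄≡ E≡ |q|≡c surplus =
  ≤-trans (surplus≤∣-∣ (ones u) (zeros u) (g + a) (witness-surplus 𝒟 r q c a g 𝒟̄≡ |q|≡c surplus))
          (disc-≥ (complement 𝒟 ++ E) u (subst (λ s → u ∈ csub s) (sym regroup) (factor-∈-csub (oneBlock c) u z)))
  where
  open ≡-Reasoning
  u = r ++ q ++ zeroBlock a
  regroup : complement 𝒟 ++ E ≡ oneBlock c ++ u ++ z
  regroup = begin
    complement 𝒟 ++ E                            ≡⟨ cong₂ _++_ 𝒟̄≡ E≡ ⟩
    (oneBlock c ++ r) ++ q ++ zeroBlock a ++ z   ≡⟨ ++-assoc (oneBlock c) r _ ⟩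
    oneBlock c ++ r ++ q ++ zeroBlock a ++ z     ≡⟨ cong (λ t → oneBlock c ++ r ++ t) (sym (++-assoc q (zeroBlock a) z)) ⟩
    oneBlock c ++ r ++ (q ++ zeroBlock a) ++ z   ≡⟨ cong (oneBlock c ++_) (sym (++-assoc r (q ++ zeroBlock a) z)) ⟩
    oneBlock c ++ u ++ z                         ∎

room-for-suffix : ∀ a c y → c + length (zeroBlock a) ≤ length (firstNecklace a (suc c) ++ y)
room-for-suffix a c y = begin
  c + length (zeroBlock a)                 ≡⟨ cong (c +_) (length-replicate a) ⟩
  c + a                                    ≤⟨ n≤1+n (c + a) ⟩
  suc c + a                                ≡⟨ +-comm (suc c) a ⟩
  a + suc c                                ≡⟨ sym (firstNecklace-length a (suc c)) ⟩
  length (firstNecklace a (suc c))         ≤⟨ m≤m+n _ (length y) ⟩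
  length (firstNecklace a (suc c)) + length y ≡⟨ sym (length-++ (firstNecklace a (suc c))) ⟩
  length (firstNecklace a (suc c) ++ y)    ∎
  where open ≤-Reasoning

-- The estimate for n = a + b with a ≥ 1 and 1 ≤ b ≤ a + 2 (here b = c + 1).
discrepancy-bound : ∀ a c → 1 ≤ a → c ≤ suc a →
  ((a + suc c ∸ 1) C a) + a ≤ disc (Dbar (a + 1) (a + suc c) ++ Dr (suc c) (a + suc c))
discrepancy-bound a c a≥1 c≤a+1
  with D-starts-with-firstNecklace a (suc c) (a + suc c) refl a≥1 (s≤s z≤n)
     | Dbar-prefix c (a + 1) (a + suc c) (trans (+-comm c (a + 1)) (+-assoc a 1 c)) (m≤n+m 1 a)
... | r₂ , 𝒟ᵦ≡ | r , 𝒟̄≡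
  with suffix-to-front c (D (suc c) (a + suc c)) (zeroBlock a) (oneBlock (suc c) ++ r₂)
         (trans 𝒟ᵦ≡ (++-assoc (zeroBlock a) (oneBlock (suc c)) r₂))
         (subst (λ w → c + length (zeroBlock a) ≤ length w) (sym 𝒟ᵦ≡) (room-for-suffix a c r₂))
...   | q , z , 𝒟ʳ≡ , |q|≡c =
  discrepancy-from-shapes (D (a + 1) n) (Dr (suc c) n) r q z c a ((n ∸ 1) C a) 𝒟̄≡ 𝒟ʳ≡ |q|≡c balance
  where
  n = a + suc c
  balance : (n ∸ 1) C a + zeros (D (a + 1) n) ≤ ones (D (a + 1) n)
  balance = subst (λ d → (n ∸ 1) C a + zeros (D d n) ≤ ones (D d n)) (+-comm 1 a)
    (D-surplus n a (≤-trans a≥1 (m≤m+n a (suc c))) (≤-trans (+-monoʳ-≤ a (s≤s c≤a+1)) (≤-reflexive (+-suc a (suc a)))))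

⌈n/2⌉≤1+⌊n/2⌋ : ∀ n → ⌈ n /2⌉ ≤ suc ⌊ n /2⌋
⌈n/2⌉≤1+⌊n/2⌋ zero          = z≤n
⌈n/2⌉≤1+⌊n/2⌋ (suc zero)    = s≤s z≤n
⌈n/2⌉≤1+⌊n/2⌋ (suc (suc n)) = s≤s (⌈n/2⌉≤1+⌊n/2⌋ n)

theorem2 : (n : ℕ) → 1 ≤ n →
    ((n ∸ 1) C ⌊ n /2⌋) + ⌊ n /2⌋ ≤ disc (Dbar (⌊ n /2⌋ + 1) n ++ Dr ⌈ n /2⌉ n)
theorem2 (suc zero)        _ = s≤s z≤n
theorem2 n@(suc (suc m)) _ =
  subst (λ t → ((t ∸ 1) C ⌊ n /2⌋) + ⌊ n /2⌋ ≤ disc (Dbar (⌊ n /2⌋ + 1) t ++ Dr ⌈ n /2⌉ t))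
        (⌊n/2⌋+⌈n/2⌉≡n n)
        (discrepancy-bound ⌊ n /2⌋ ⌈ m /2⌉ (s≤s z≤n) (m≤n⇒m≤1+n (⌈n/2⌉≤1+⌊n/2⌋ m)))
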